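{- Let $A$ be a finite set of real numbers with $|A|$ sufficiently large. Then $A$ contains a subset $B$ of at most $20\log_2|A|$ elements such that $\left(\frac{|B|}{2}\right)^{\ast}B$ has cardinality at least $|A|$.
   Context: For a set $B$ and positive integer $k$, $k^{\ast}B=\{b_1+\dots+b_k : b_i\in B \text{ pairwise distinct}\}$. -}

module Defs where

open import Data.Nat using (ℕ; _/_) renaming (_≤_ to _≤ℕ_)
open import Data.Product using (Σ; ∃; _×_; _,_)
open import Data.List using (List; []; _∷_; foldr; length)
open import Data.List.Relation.Unary.All using (All)
open import Data.List.Relation.Unary.Unique.Propositional using (Unique)
open import Data.List.Relation.Binary.Sublist.Propositional using (_⊆_)
open import Data.List.Membership.Propositional using (_∈_)
open import Relation.Nullary using (¬_)
open import Relation.Binary.PropositionalEquality using (_≡_)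
open import Relation.Binary.Structures using (IsTotalOrder)
open import Algebra.Structures using (IsCommutativeRing)

-- The real numbers, axiomatised as a Dedekind-complete ordered field
-- (unique up to isomorphism classically).  Equality is propositional.
record RealNumbers : Set₁ where
  field
    ℝ   : Set
    _+_ : ℝ → ℝ → ℝ
    _*_ : ℝ → ℝ → ℝ
    -_  : ℝ → ℝ
    0r  : ℝ
    1r  : ℝ
    _≤_ : ℝ → ℝ → Set
    isCommutativeRing : IsCommutativeRing _≡_ _+_ _*_ -_ 0r 1r
    0≢1     : ¬ (0r ≡ 1r)
    inverse : ∀ x → ¬ (x ≡ 0r) → Σ ℝ (λ y → (x * y) ≡ 1r)
    isTotalOrder : IsTotalOrder _≡_ _≤_
    +-monoˡ-≤ : ∀ {x y} z → x ≤ y → (x + z) ≤ (y + z)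
    *-nonneg  : ∀ {x y} → 0r ≤ x → 0r ≤ y → 0r ≤ (x * y)
    lub : (S : ℝ → Set) → ∃ S → ∃ (λ u → ∀ s → S s → s ≤ u) →
          ∃ (λ l → (∀ s → S s → s ≤ l) × (∀ u → (∀ s → S s → s ≤ u) → l ≤ u))

module _ (R : RealNumbers) where
  open RealNumbers R

  sumℝ : List ℝ → ℝ
  sumℝ = foldr _+_ 0r

  -- s ∈ k^* B, for B a duplicate-free list: s is the sum of k entries of B
  -- taken at distinct positions (a length-k sublist of B).
  InRestrictedSumset : ℕ → List ℝ → ℝ → Set
  InRestrictedSumset k B s = ∃ (λ C → (C ⊆ B) × (length C ≡ k) × (sumℝ C ≡ s))

  CardAtLeast : (ℝ → Set) → ℕ → Set
  CardAtLeast P n = ∃ (λ L → Unique L × All P L × (n ≤ℕ length L))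

{-# OPTIONS --safe #-}
module Submission where

-- Enumerate A as a₀ < a₁ < … < a_{n-1}. If T is a family of distinct s-fold sums of elements
-- a_j with lo < j < hi and diam T < a_hi − a_lo, then a_lo + T and a_hi + T are disjoint, so
-- adding the two endpoints doubles the number of distinct sums. Cut the interior of the index
-- window [lo, hi] into two halves: one of them is narrower than (a_hi − a_lo)/2, and by
-- induction the sums built inside it have diameter at most twice its width, so the doubling
-- applies. Each halving of the window costs two elements and doubles the family, so about
-- 2 log₂ n elements give at least n sums. Windows of at most 15 indices are handled by
-- doubling the single elements of their interior; this leaves a surplus of at most 11
-- elements not matched by summands, which the top level removes by adding as many elements
-- of the unused half to every sum.

open import Defs
open import Algebra.Bundles using (CommutativeRing)
open import Data.Nat as ℕ using (ℕ; zero; suc; s≤s)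
open import Data.Product using (∃; ∃₂; _×_; _,_; proj₁; proj₂)
open import Data.Sum as Sum using (_⊎_; inj₁; inj₂)
open import Function using (_∘_)
open import Data.List using (List; []; _∷_; _++_; map; length; foldr; applyUpTo)
open import Data.List.Properties using (length-++; length-map; map-++; length-applyUpTo)
open import Data.List.Membership.Propositional using (_∈_)
open import Data.List.Membership.Propositional.Properties using (∈-map⁺; ∈-map⁻; ∈-++⁻)
open import Data.List.Relation.Unary.Any using (here; there)
open import Data.List.Relation.Unary.All as All using (All; []; _∷_)
import Data.List.Relation.Unary.All.Properties as All
open import Data.List.Relation.Unary.AllPairs using (AllPairs; []; _∷_)
open import Data.List.Relation.Unary.Unique.Propositional using (Unique)
import Data.List.Relation.Unary.Unique.Propositional.Properties as Unique
open import Data.List.Relation.Binary.Disjoint.Propositional using (Disjoint)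
open import Data.List.Relation.Binary.Sublist.Propositional using (_⊆_; _∷_; _∷ʳ_; ⊆-refl; ⊆-trans; from∈)
import Data.List.Relation.Binary.Sublist.Propositional.Properties as Sublist
open import Data.List.Relation.Binary.Permutation.Propositional
  using (_↭_; ↭-refl; ↭-prep; ↭-swap; ↭-trans; ↭-sym)
open import Data.List.Relation.Binary.Permutation.Propositional.Properties using (All-resp-↭; ∈-resp-↭; ↭-length)
open import Relation.Binary.Bundles using (Poset)
open import Relation.Binary.Structures using (IsTotalOrder)
open import Relation.Binary.PropositionalEquality
  using (_≡_; _≢_; refl; sym; trans; cong; cong₂; subst; subst₂; ≢-sym)

module OrderedField (R : RealNumbers) where
  open RealNumbers R public using (ℝ; 0r; +-monoˡ-≤) renaming (_≤_ to infix 4 _≤_)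
  open RealNumbers R using (isCommutativeRing; isTotalOrder)

  commutativeRing : CommutativeRing _ _
  commutativeRing = record { isCommutativeRing = isCommutativeRing }

  poset : Poset _ _ _
  poset = record { isPartialOrder = IsTotalOrder.isPartialOrder isTotalOrder }

  open CommutativeRing commutativeRing public using (_+_; +-comm; +-assoc; +-identityˡ; +-identityʳ)
  open CommutativeRing commutativeRing using (-_)
  open IsTotalOrder isTotalOrder public using (total) renaming (refl to ≤-refl; trans to ≤-trans)
  open IsTotalOrder isTotalOrder using (antisym)
  open import Relation.Binary.Properties.Poset poset public using (_<_; <⇒≉; <-trans)
  open import Algebra.Solver.CommutativeMonoid (CommutativeRing.+-commutativeMonoid commutativeRing) public
    using (solve; _⊕_; _⊜_)
  open import Algebra.Properties.CommutativeSemigroup (CommutativeRing.+-commutativeSemigroup commutativeRing) public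
    using (xy∙z≈xz∙y)
  open import Algebra.Properties.Group (CommutativeRing.+-group commutativeRing)
    using (x≈z//y; ∙-cancelˡ; ∙-cancelʳ)

  +-cancelˡ-≡ : ∀ x {y z} → x + y ≡ x + z → y ≡ z
  +-cancelˡ-≡ x = ∙-cancelˡ x _ _

  +-cancelʳ-≡ : ∀ z {x y} → x + z ≡ y + z → x ≡ y
  +-cancelʳ-≡ z = ∙-cancelʳ z _ _

  <⇒≤ : ∀ {x y} → x < y → x ≤ y
  <⇒≤ = proj₁

  <-≤-trans : ∀ {x y z} → x < y → y ≤ z → x < z
  <-≤-trans (x≤y , x≢y) y≤z = ≤-trans x≤y y≤z , λ { refl → x≢y (antisym x≤y y≤z) }

  +-monoʳ-≤ : ∀ {x y} z → x ≤ y → z + x ≤ z + y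
  +-monoʳ-≤ {x} {y} z x≤y = subst₂ _≤_ (+-comm x z) (+-comm y z) (+-monoˡ-≤ z x≤y)

  +-mono-≤ : ∀ {x y u v} → x ≤ y → u ≤ v → x + u ≤ y + v
  +-mono-≤ {y = y} {u} x≤y u≤v = ≤-trans (+-monoˡ-≤ u x≤y) (+-monoʳ-≤ y u≤v)

  +-cancelʳ-≤ : ∀ {x y} z → x + z ≤ y + z → x ≤ y
  +-cancelʳ-≤ {x} {y} z x+z≤y+z =
    subst₂ _≤_ (sym (x≈z//y x z _ refl)) (sym (x≈z//y y z _ refl)) (+-monoˡ-≤ (- z) x+z≤y+z)

  +-monoˡ-< : ∀ {x y} z → x < y → x + z < y + z
  +-monoˡ-< {x} {y} z (x≤y , x≢y) = +-monoˡ-≤ z x≤y , x≢y ∘ +-cancelʳ-≡ z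

  +-mono-<-≤ : ∀ {x y u v} → x < y → u ≤ v → x + u < y + v
  +-mono-<-≤ {y = y} {u} x<y u≤v = <-≤-trans (+-monoˡ-< u x<y) (+-monoʳ-≤ y u≤v)

  +-mono-≤-< : ∀ {x y u v} → x ≤ y → u < v → x + u < y + v
  +-mono-≤-< {x} {y} {u} {v} x≤y u<v = subst₂ _<_ (+-comm u x) (+-comm v y) (+-mono-<-≤ u<v x≤y)

  +-mono-< : ∀ {x y u v} → x < y → u < v → x + u < y + v
  +-mono-< x<y u<v = +-mono-<-≤ x<y (<⇒≤ u<v)

  -- Linear inequalities are proved by adding up hypotheses and cancelling a common summand K,
  -- after the monoid solver has rearranged both sides into the form _ + K.
  ≤-cancelling : ∀ {x y X Y} K → x ≤ y → x ≡ X + K → y ≡ Y + K → X ≤ Y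
  ≤-cancelling K x≤y refl refl = +-cancelʳ-≤ K x≤y

  <-cancelling : ∀ {x y X Y} K → x < y → x ≡ X + K → y ≡ Y + K → X < Y
  <-cancelling K (x≤y , x≢y) refl refl = +-cancelʳ-≤ K x≤y , λ { refl → x≢y refl }

module RestrictedSums (R : RealNumbers) where
  open OrderedField R

  sumℝ-++ : ∀ xs ys → sumℝ R (xs ++ ys) ≡ sumℝ R xs + sumℝ R ys
  sumℝ-++ [] ys = sym (+-identityˡ _)
  sumℝ-++ (x ∷ xs) ys = trans (cong (x +_) (sumℝ-++ xs ys)) (sym (+-assoc x _ _))

  module _ {k : ℕ} {B : List ℝ} {t : ℝ} where

    sumset-⊆ : ∀ {B′} → B ⊆ B′ → InRestrictedSumset R k B t → InRestrictedSumset R k B′ t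
    sumset-⊆ B⊆B′ (C , C⊆B , len , sum) = C , ⊆-trans C⊆B B⊆B′ , len , sum

    sumset-∷ : ∀ x → InRestrictedSumset R k B t → InRestrictedSumset R (suc k) (x ∷ B) (x + t)
    sumset-∷ x (C , C⊆B , refl , refl) = x ∷ C , refl ∷ C⊆B , refl , refl

    sumset-++ : ∀ Q → InRestrictedSumset R k B t →
                InRestrictedSumset R (k ℕ.+ length Q) (B ++ Q) (t + sumℝ R Q)
    sumset-++ Q (C , C⊆B , refl , refl) =
      C ++ Q , Sublist.++⁺ C⊆B ⊆-refl , length-++ C , sumℝ-++ C Q

  sumset-∈ : ∀ {b B} → b ∈ B → InRestrictedSumset R 1 B b
  sumset-∈ b∈B = _ ∷ [] , from∈ b∈B , refl , +-identityʳ _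

  -- diam T ≤ q − p, stated without subtraction
  DiamBound : List ℝ → ℝ → ℝ → Set
  DiamBound T p q = ∀ {t u} → t ∈ T → u ∈ T → t + p ≤ u + q

  diamBound-between : ∀ {T p q} → All (λ t → p ≤ t × t ≤ q) T → DiamBound T p q
  diamBound-between {q = q} bounds t∈T u∈T =
    subst₂ _≤_ refl (+-comm q _) (+-mono-≤ (proj₂ (All.lookup bounds t∈T)) (proj₁ (All.lookup bounds u∈T)))

  diamBound-shift : ∀ {T p q} σ → DiamBound T p q → DiamBound (map (_+ σ) T) p q
  diamBound-shift {p = p} {q} σ bound t+σ∈ u+σ∈ with ∈-map⁻ (_+ σ) t+σ∈ | ∈-map⁻ (_+ σ) u+σ∈
  ... | t , t∈T , refl | u , u∈T , refl =
    subst₂ _≤_ (xy∙z≈xz∙y t p σ) (xy∙z≈xz∙y u q σ) (+-monoˡ-≤ σ (bound t∈T u∈T))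

  unique-shift : ∀ {T} σ → Unique T → Unique (map (_+ σ) T)
  unique-shift σ = Unique.map⁺ (+-cancelʳ-≡ σ)

  translates : ℝ → ℝ → List ℝ → List ℝ
  translates x y T = map (x +_) T ++ map (y +_) T

  length-translates : ∀ x y T → length (translates x y T) ≡ length T ℕ.+ length T
  length-translates x y T =
    trans (length-++ (map (x +_) T)) (cong₂ ℕ._+_ (length-map (x +_) T) (length-map (y +_) T))

  sumset-translates : ∀ {k B T} x y → All (InRestrictedSumset R k B) T →
                      All (InRestrictedSumset R (suc k) (x ∷ y ∷ B)) (translates x y T)
  sumset-translates {k} {B} x y sums =
    All.++⁺ (All.map⁺ (All.map with-x sums)) (All.map⁺ (All.map with-y sums))
    where
    with-x : ∀ {t} → InRestrictedSumset R k B t → InRestrictedSumset R (suc k) (x ∷ y ∷ B) (x + t)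
    with-x t∈ = sumset-∷ x (sumset-⊆ (y ∷ʳ ⊆-refl) t∈)
    with-y : ∀ {t} → InRestrictedSumset R k B t → InRestrictedSumset R (suc k) (x ∷ y ∷ B) (y + t)
    with-y t∈ = sumset-⊆ (x ∷ʳ ⊆-refl) (sumset-∷ y t∈)

  translates-separated : ∀ {T p q x y t u} → DiamBound T p q → q + x < p + y → t ∈ T → u ∈ T →
                         x + t < y + u
  translates-separated {p = p} {q} {x} {y} {t} {u} bound narrow t∈T u∈T =
    <-cancelling (p + q) (+-mono-≤-< (bound t∈T u∈T) narrow) eqˡ eqʳ
    where
    eqˡ : (t + p) + (q + x) ≡ (x + t) + (p + q)
    eqˡ = solve 4 (λ t p q x → (t ⊕ p) ⊕ (q ⊕ x) ⊜ (x ⊕ t) ⊕ (p ⊕ q)) refl t p q x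
    eqʳ : (u + q) + (p + y) ≡ (y + u) + (p + q)
    eqʳ = solve 4 (λ u p q y → (u ⊕ q) ⊕ (p ⊕ y) ⊜ (y ⊕ u) ⊕ (p ⊕ q)) refl u p q y

  unique-translates : ∀ {T p q x y} → Unique T → DiamBound T p q → q + x < p + y →
                      Unique (translates x y T)
  unique-translates {T} {x = x} {y} unique bound narrow =
    Unique.++⁺ (Unique.map⁺ (+-cancelˡ-≡ x) unique) (Unique.map⁺ (+-cancelˡ-≡ y) unique) apart
    where
    apart : Disjoint (map (x +_) T) (map (y +_) T)
    apart (v∈xT , v∈yT) with ∈-map⁻ (x +_) v∈xT | ∈-map⁻ (y +_) v∈yT
    ... | t , t∈T , refl | u , u∈T , x+t≡y+u = <⇒≉ (translates-separated bound narrow t∈T u∈T) x+t≡y+u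

  ∈-translates⁻ : ∀ {x y T v} → x ≤ y → v ∈ translates x y T →
                  ∃₂ λ X t → t ∈ T × v ≡ X + t × x ≤ X × X ≤ y
  ∈-translates⁻ {x} {y} {T} x≤y v∈ with ∈-++⁻ (map (x +_) T) v∈
  ... | inj₁ v∈xT = let t , t∈T , eq = ∈-map⁻ (x +_) v∈xT in x , t , t∈T , eq , ≤-refl , x≤y
  ... | inj₂ v∈yT = let t , t∈T , eq = ∈-map⁻ (y +_) v∈yT in y , t , t∈T , eq , x≤y , ≤-refl

  diamBound-translates : ∀ {T p q x y} → x ≤ y → DiamBound T p q → q + x ≤ p + y →
                         DiamBound (translates x y T) (x + x) (y + y)
  diamBound-translates {p = p} {q} {x} {y} x≤y bound narrow v∈ w∈
    with ∈-translates⁻ x≤y v∈ | ∈-translates⁻ x≤y w∈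
  ... | X , t , t∈T , refl , _ , X≤y | Y , u , u∈T , refl , x≤Y , _ =
    ≤-cancelling (p + q) (+-mono-≤ (+-mono-≤ (+-mono-≤ X≤y (bound t∈T u∈T)) narrow) x≤Y) eqˡ eqʳ
    where
    eqˡ : ((X + (t + p)) + (q + x)) + x ≡ ((X + t) + (x + x)) + (p + q)
    eqˡ = solve 5 (λ X t p q x → ((X ⊕ (t ⊕ p)) ⊕ (q ⊕ x)) ⊕ x ⊜ ((X ⊕ t) ⊕ (x ⊕ x)) ⊕ (p ⊕ q))
                refl X t p q x
    eqʳ : ((y + (u + q)) + (p + y)) + Y ≡ ((Y + u) + (y + y)) + (p + q)
    eqʳ = solve 5 (λ y u q p Y → ((y ⊕ (u ⊕ q)) ⊕ (p ⊕ y)) ⊕ Y ⊜ ((Y ⊕ u) ⊕ (y ⊕ y)) ⊕ (p ⊕ q))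
                refl y u q p Y

  -- one of [x₁, x₂] and [x₃, x₄] is shorter than half of (x₀, x₅)
  narrower-half : ∀ {x₀ x₁ x₂ x₃ x₄ x₅} → x₀ < x₁ → x₂ < x₃ → x₄ < x₅ →
                  (x₂ + x₂) + x₀ < (x₁ + x₁) + x₅ ⊎ (x₄ + x₄) + x₀ < (x₃ + x₃) + x₅
  narrower-half {x₀} {x₁} {x₂} {x₃} {x₄} {x₅} x₀<x₁ x₂<x₃ x₄<x₅ =
    Sum.map first-narrow second-narrow (total (x₂ + x₃) (x₄ + x₁))
    where
    gaps : (x₀ + x₂) + x₄ < (x₁ + x₃) + x₅
    gaps = +-mono-< (+-mono-< x₀<x₁ x₂<x₃) x₄<x₅
    first-narrow : x₂ + x₃ ≤ x₄ + x₁ → (x₂ + x₂) + x₀ < (x₁ + x₁) + x₅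
    first-narrow shorter = <-cancelling (x₃ + x₄) (+-mono-<-≤ gaps shorter) eqˡ eqʳ
      where
      eqˡ : ((x₀ + x₂) + x₄) + (x₂ + x₃) ≡ ((x₂ + x₂) + x₀) + (x₃ + x₄)
      eqˡ = solve 4 (λ a c d e → ((a ⊕ c) ⊕ e) ⊕ (c ⊕ d) ⊜ ((c ⊕ c) ⊕ a) ⊕ (d ⊕ e))
                  refl x₀ x₂ x₃ x₄
      eqʳ : ((x₁ + x₃) + x₅) + (x₄ + x₁) ≡ ((x₁ + x₁) + x₅) + (x₃ + x₄)
      eqʳ = solve 4 (λ b d e f → ((b ⊕ d) ⊕ f) ⊕ (e ⊕ b) ⊜ ((b ⊕ b) ⊕ f) ⊕ (d ⊕ e))
                  refl x₁ x₃ x₄ x₅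
    second-narrow : x₄ + x₁ ≤ x₂ + x₃ → (x₄ + x₄) + x₀ < (x₃ + x₃) + x₅
    second-narrow shorter = <-cancelling (x₁ + x₂) (+-mono-<-≤ gaps shorter) eqˡ eqʳ
      where
      eqˡ : ((x₀ + x₂) + x₄) + (x₄ + x₁) ≡ ((x₄ + x₄) + x₀) + (x₁ + x₂)
      eqˡ = solve 4 (λ a b c e → ((a ⊕ c) ⊕ e) ⊕ (e ⊕ b) ⊜ ((e ⊕ e) ⊕ a) ⊕ (b ⊕ c))
                  refl x₀ x₁ x₂ x₄
      eqʳ : ((x₁ + x₃) + x₅) + (x₂ + x₃) ≡ ((x₃ + x₃) + x₅) + (x₁ + x₂)
      eqʳ = solve 4 (λ b c d f → ((b ⊕ d) ⊕ f) ⊕ (c ⊕ d) ⊜ ((d ⊕ d) ⊕ f) ⊕ (b ⊕ c))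
                  refl x₁ x₂ x₃ x₅

module Sorting (R : RealNumbers) where
  open OrderedField R

  insert : ℝ → List ℝ → List ℝ
  insert x [] = x ∷ []
  insert x (y ∷ ys) with total x y
  ... | inj₁ _ = x ∷ y ∷ ys
  ... | inj₂ _ = y ∷ insert x ys

  insert-↭ : ∀ x ys → insert x ys ↭ x ∷ ys
  insert-↭ x [] = ↭-refl
  insert-↭ x (y ∷ ys) with total x y
  ... | inj₁ _ = ↭-refl
  ... | inj₂ _ = ↭-trans (↭-prep y (insert-↭ x ys)) (↭-swap y x ↭-refl)

  insert-increasing : ∀ {x ys} → AllPairs _<_ ys → All (x ≢_) ys → AllPairs _<_ (insert x ys)
  insert-increasing {ys = []} [] [] = [] ∷ []
  insert-increasing {x} {y ∷ ys} (y<ys ∷ ys↑) (x≢y ∷ x∉ys) with total x y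
  ... | inj₁ x≤y = (x<y ∷ All.map (<-trans x<y) y<ys) ∷ y<ys ∷ ys↑
    where
    x<y : x < y
    x<y = x≤y , x≢y
  ... | inj₂ y≤x = All-resp-↭ (↭-sym (insert-↭ x ys)) ((y≤x , ≢-sym x≢y) ∷ y<ys)
                   ∷ insert-increasing ys↑ x∉ys

  sort : List ℝ → List ℝ
  sort = foldr insert []

  sort-↭ : ∀ xs → sort xs ↭ xs
  sort-↭ [] = ↭-refl
  sort-↭ (x ∷ xs) = ↭-trans (insert-↭ x (sort xs)) (↭-prep x (sort-↭ xs))

  sort-increasing : ∀ {xs} → Unique xs → AllPairs _<_ (sort xs)
  sort-increasing {[]} [] = []
  sort-increasing {x ∷ xs} (x∉xs ∷ xs-unique) =
    insert-increasing (sort-increasing xs-unique) (All-resp-↭ (↭-sym (sort-↭ xs)) x∉xs)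

  -- beyond the end of the list, `at` returns the junk value 0r
  at : List ℝ → ℕ → ℝ
  at [] _ = 0r
  at (x ∷ xs) zero = x
  at (x ∷ xs) (suc i) = at xs i

  at-∈ : ∀ {xs i} → i ℕ.< length xs → at xs i ∈ xs
  at-∈ {x ∷ xs} {zero} _ = here refl
  at-∈ {x ∷ xs} {suc i} (s≤s i<n) = there (at-∈ i<n)

  at-increasing : ∀ {xs i j} → AllPairs _<_ xs → i ℕ.< j → j ℕ.< length xs → at xs i < at xs j
  at-increasing {x ∷ xs} {zero} {suc j} (x<xs ∷ _) _ (s≤s j<n) = All.lookup x<xs (at-∈ j<n)
  at-increasing {x ∷ xs} {suc i} {suc j} (_ ∷ xs↑) (s≤s i<j) (s≤s j<n) = at-increasing xs↑ i<j j<n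

  record IncreasingEnumeration (A : List ℝ) : Set where
    field
      a : ℕ → ℝ
      a-increasing : ∀ {i j} → i ℕ.< j → j ℕ.< length A → a i < a j
      a-∈ : ∀ {i} → i ℕ.< length A → a i ∈ A

  enumerate : ∀ {A} → Unique A → IncreasingEnumeration A
  enumerate {A} A-unique = record
    { a = at (sort A)
    ; a-increasing = λ i<j j<n → at-increasing (sort-increasing A-unique) i<j (in-sorted j<n)
    ; a-∈ = λ i<n → ∈-resp-↭ (sort-↭ A) (at-∈ (in-sorted i<n))
    }
    where
    in-sorted : ∀ {i} → i ℕ.< length A → i ℕ.< length (sort A)
    in-sorted = subst (_ ℕ.<_) (sym (↭-length (sort-↭ A)))

module Halving where
  open import Data.Nat using (_≤_; _+_; ⌊_/2⌋; ⌈_/2⌉; z≤n; _≤?_)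
  open import Data.Nat.Properties using (+-suc; +-mono-≤; ≰⇒>; ≤-trans; ≤-refl; 1+n≰n)
  open import Relation.Nullary using (yes; no; contradiction)

  Balanced : ℕ → ℕ → Set
  Balanced x p = x ≤ suc (p + p) × p + p ≤ suc x

  balanced-2+ : ∀ {x p} → Balanced x p → Balanced (2 + x) (suc p)
  balanced-2+ {x} {p} (lower , upper) =
    s≤s (s≤s (subst (x ≤_) (sym (+-suc p p)) lower)) ,
    subst (_≤ 3 + x) (sym (cong suc (+-suc p p))) (s≤s (s≤s upper))

  ⌊/2⌋-balanced : ∀ x → Balanced x ⌊ x /2⌋
  ⌊/2⌋-balanced 0 = z≤n , z≤n
  ⌊/2⌋-balanced 1 = ≤-refl , z≤n
  ⌊/2⌋-balanced (suc (suc x)) = balanced-2+ (⌊/2⌋-balanced x)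

  ⌈/2⌉-balanced : ∀ x → Balanced x ⌈ x /2⌉
  ⌈/2⌉-balanced 0 = z≤n , z≤n
  ⌈/2⌉-balanced 1 = s≤s z≤n , ≤-refl
  ⌈/2⌉-balanced (suc (suc x)) = balanced-2+ (⌈/2⌉-balanced x)

  balanced-≥ : ∀ {x p} k → Balanced x p → k + k ≤ x → k ≤ p
  balanced-≥ {x} {p} k (lower , _) k+k≤x with k ≤? p
  ... | yes k≤p = k≤p
  ... | no k≰p = contradiction (≤-trans too-big (≤-trans k+k≤x lower)) 1+n≰n
    where
    too-big : suc (suc (p + p)) ≤ k + k
    too-big = subst (_≤ k + k) (cong suc (+-suc p p)) (+-mono-≤ (≰⇒> k≰p) (≰⇒> k≰p))

module Windows (R : RealNumbers) (n : ℕ) (a : ℕ → RealNumbers.ℝ R)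
               (a-increasing : ∀ {i j} → i ℕ.< j → j ℕ.< n → OrderedField._<_ R (a i) (a j)) where
  open import Data.Nat using (_≤_; _<_; _+_; _*_; _^_; _∸_; _/_; z≤n; ⌊_/2⌋; ⌈_/2⌉; _≤?_)
  open import Data.Nat.Induction using (<-rec)
  open import Relation.Nullary using (yes; no)
  open import Data.Nat.Properties
    using ( ≤-refl; ≤-trans; <-trans; ≤-<-trans; <-≤-trans; <⇒≤; <⇒≢; ≤-reflexive; ≤-pred; <-cmp; ≰⇒>
          ; n<1+n; n≤1+n; m≤m+n; m≤n+m; m<m+n; m≤n⇒m<n∨m≡n; m+[n∸m]≡n; ∸-monoˡ-≤; ≤ᵇ⇒≤; ⌊n/2⌋+⌈n/2⌉≡n
          ; +-monoʳ-≤; +-monoˡ-≤; +-monoʳ-<; +-mono-≤; *-monoʳ-≤; *-monoˡ-≤; *-mono-≤; *-comm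
          ; ^-distribˡ-+-*; ^-monoʳ-≤; ^-monoˡ-≤; ^-*-assoc; module ≤-Reasoning)
  open import Data.Nat.DivMod using (m*n/n≡m)
  open import Data.Nat.Tactic.RingSolver using (solve-∀)
  open import Relation.Binary.Definitions using (tri<; tri≈; tri>)
  open import Data.Empty using (⊥-elim)
  open OrderedField R using (ℝ; <⇒≉)
    renaming ( _<_ to _<ᵣ_; _≤_ to _≤ᵣ_; _+_ to _+ᵣ_; ≤-refl to ≤ᵣ-refl; <⇒≤ to <ᵣ⇒≤ᵣ
             ; +-comm to +ᵣ-comm; +-mono-< to +ᵣ-mono-<)
  open RestrictedSums R
  open Halving

  a-monotone : ∀ {i j} → i ≤ j → j < n → a i ≤ᵣ a j
  a-monotone i≤j j<n with m≤n⇒m<n∨m≡n i≤j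
  ... | inj₁ i<j = <ᵣ⇒≤ᵣ (a-increasing i<j j<n)
  ... | inj₂ refl = ≤ᵣ-refl

  a-injective : ∀ {i j} → i < n → j < n → a i ≡ a j → i ≡ j
  a-injective {i} {j} i<n j<n ai≡aj with <-cmp i j
  ... | tri< i<j _ _ = ⊥-elim (<⇒≉ (a-increasing i<j j<n) ai≡aj)
  ... | tri≈ _ i≡j _ = i≡j
  ... | tri> _ _ j<i = ⊥-elim (<⇒≉ (a-increasing j<i i<n) (sym ai≡aj))

  unique-map-a : ∀ {I} → Unique I → All (_< n) I → Unique (map a I)
  unique-map-a [] [] = []
  unique-map-a (i∉I ∷ I-unique) (i<n ∷ I<n) =
    All.map⁺ (All.zipWith (λ (i≢j , j<n) → i≢j ∘ a-injective i<n j<n) (i∉I , I<n))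
    ∷ unique-map-a I-unique I<n

  record Window : Set where
    constructor [_,+_]
    field
      start len : ℕ

    end : ℕ
    end = start + len

  open Window

  _∈ʷ_ : ℕ → Window → Set
  i ∈ʷ W = start W ≤ i × i ≤ end W

  Inside : Window → ℕ → Set
  Inside W i = start W < i × i < end W

  _⊏_ : Window → Window → Set
  V ⊏ W = start W < start V × end V < end W

  ⊏-inside : ∀ {V W i} → V ⊏ W → i ∈ʷ V → Inside W i
  ⊏-inside (lo<start , end<hi) (start≤i , i≤end) = <-≤-trans lo<start start≤i , ≤-<-trans i≤end end<hi

  firstIndices : Window → ℕ → List ℕ
  firstIndices Z k = applyUpTo (start Z +_) k

  length-firstIndices : ∀ Z k → length (firstIndices Z k) ≡ k
  length-firstIndices Z = length-applyUpTo (start Z +_)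

  unique-firstIndices : ∀ Z k → Unique (firstIndices Z k)
  unique-firstIndices Z k = Unique.applyUpTo⁺₁ (start Z +_) k (λ i<j _ → <⇒≢ (+-monoʳ-< (start Z) i<j))

  firstIndices-within : ∀ Z {k} → k ≤ suc (len Z) → All (_∈ʷ Z) (firstIndices Z k)
  firstIndices-within Z {k} k≤ =
    All.applyUpTo⁺₁ (start Z +_) k (λ i<k → m≤m+n _ _ , +-monoʳ-≤ (start Z) (≤-pred (≤-trans i<k k≤)))

  record DistinctSums : Set where
    field
      I : List ℕ
      s : ℕ
      T : List ℝ
      I-unique : Unique I
      T-unique : Unique T
      T-sums : All (InRestrictedSumset R s (map a I)) T

  open DistinctSums

  singletons : (J : List ℕ) → Unique J → All (_< n) J → DistinctSums
  singletons J J-unique J<n = record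
    { I = J
    ; s = 1
    ; T = map a J
    ; I-unique = J-unique
    ; T-unique = unique-map-a J-unique J<n
    ; T-sums = All.map⁺ (All.tabulate (sumset-∈ ∘ ∈-map⁺ a))
    }

  pad : (S : DistinctSums) (Q : List ℕ) → Unique Q → Disjoint (I S) Q → DistinctSums
  pad S Q Q-unique apart = record
    { I = I S ++ Q
    ; s = s S + length Q
    ; T = map (_+ᵣ σ) (T S)
    ; I-unique = Unique.++⁺ (I-unique S) Q-unique apart
    ; T-unique = unique-shift σ (T-unique S)
    ; T-sums = All.map⁺ (All.map padded (T-sums S))
    }
    where
    σ : ℝ
    σ = sumℝ R (map a Q)
    padded : ∀ {t} → InRestrictedSumset R (s S) (map a (I S)) t →
             InRestrictedSumset R (s S + length Q) (map a (I S ++ Q)) (t +ᵣ σ)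
    padded {t} t∈ = subst₂ (λ k B → InRestrictedSumset R k B (t +ᵣ σ))
                      (cong (s S +_) (length-map a Q)) (sym (map-++ a (I S) Q)) (sumset-++ (map a Q) t∈)

  diamBound-window : ∀ {V J} → All (_∈ʷ V) J → end V < n → DiamBound (map a J) (a (start V)) (a (end V))
  diamBound-window {V} J⊆V V<n = diamBound-between (All.map⁺ (All.map bounds J⊆V))
    where
    bounds : ∀ {i} → i ∈ʷ V → a (start V) ≤ᵣ a i × a i ≤ᵣ a (end V)
    bounds (start≤i , i≤end) = a-monotone start≤i (≤-<-trans i≤end V<n) , a-monotone i≤end V<n

  ⊏-narrow : ∀ {V W} → V ⊏ W → end W < n → a (end V) +ᵣ a (start W) <ᵣ a (start V) +ᵣ a (end W)
  ⊏-narrow {V} {W} (lo<start , end<hi) W<n =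
    subst (a (end V) +ᵣ a (start W) <ᵣ_) (+ᵣ-comm _ _)
      (+ᵣ-mono-< (a-increasing end<hi W<n) (a-increasing lo<start start<n))
    where
    start<n : start V < n
    start<n = ≤-<-trans (m≤m+n _ _) (<-trans end<hi W<n)

  -- diam T ≤ q − p < a (end W) − a (start W), so the translates of T by the two endpoints are disjoint
  record DoublableIn (W : Window) : Set where
    field
      sums : DistinctSums
      p q : ℝ
      inside : All (Inside W) (I sums)
      diam : DiamBound (T sums) p q
      narrow : q +ᵣ a (start W) <ᵣ p +ᵣ a (end W)

  module Doubling {W : Window} (lo<hi : start W < end W) (fits : end W < n) (D : DoublableIn W) where
    open DoublableIn D

    doubled : DistinctSums
    doubled = record
      { I = start W ∷ end W ∷ I sums
      ; s = suc (s sums)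
      ; T = translates (a (start W)) (a (end W)) (T sums)
      ; I-unique = (<⇒≢ lo<hi ∷ All.map (<⇒≢ ∘ proj₁) inside)
                   ∷ All.map (≢-sym ∘ <⇒≢ ∘ proj₂) inside
                   ∷ I-unique sums
      ; T-unique = unique-translates (T-unique sums) diam narrow
      ; T-sums = sumset-translates _ _ (T-sums sums)
      }

    doubled-within : All (_∈ʷ W) (I doubled)
    doubled-within =
      (≤-refl , <⇒≤ lo<hi) ∷ (<⇒≤ lo<hi , ≤-refl) ∷ All.map (λ (lo<i , i<hi) → <⇒≤ lo<i , <⇒≤ i<hi) inside

    doubled-diam : DiamBound (T doubled) (a (start W) +ᵣ a (start W)) (a (end W) +ᵣ a (end W))
    doubled-diam = diamBound-translates (a-monotone (<⇒≤ lo<hi) fits) diam (<ᵣ⇒≤ᵣ narrow)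

    length-doubled : length (T doubled) ≡ length (T sums) + length (T sums)
    length-doubled = length-translates _ _ (T sums)

  -- e is the surplus |I| − 2s; only windowSums-small creates it
  record WindowSums (W : Window) : Set where
    field
      sums : DistinctSums
      e : ℕ
      within : All (_∈ʷ W) (I sums)
      size : length (I sums) ≡ s sums + s sums + e
      e≤11 : e ≤ 11
      few-summands : 2 ^ s sums ≤ len W
      diam : DiamBound (T sums) (a (start W) +ᵣ a (start W)) (a (end W) +ᵣ a (end W))
      many : len W + 4 ≤ length (T sums)

  windowSums-small : ∀ lo e → 3 ≤ e → e ≤ 11 → lo + (3 + e) < n → WindowSums [ lo ,+ 3 + e ]
  windowSums-small lo e 3≤e e≤11 fits = record
    { sums = doubled
    ; e = e
    ; within = doubled-within
    ; size = cong (2 +_) (length-firstIndices V (2 + e))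
    ; e≤11 = e≤11
    ; few-summands = +-monoʳ-≤ 3 (≤-trans (s≤s z≤n) 3≤e)
    ; diam = doubled-diam
    ; many = begin
        3 + e + 4                          ≡⟨ regroup e ⟩
        (2 + e) + (2 + 3)                  ≤⟨ +-monoʳ-≤ (2 + e) (+-monoʳ-≤ 2 3≤e) ⟩
        (2 + e) + (2 + e)                  ≡⟨ cong₂ _+_ length-T length-T ⟨
        length (T sums) + length (T sums)  ≡⟨ length-doubled ⟨
        length (T doubled)                 ∎
    }
    where
    open ≤-Reasoning hiding (start)
    W V : Window
    W = [ lo ,+ 3 + e ]
    V = [ suc lo ,+ suc e ]
    J : List ℕ
    J = firstIndices V (2 + e)
    V⊏W : V ⊏ W
    V⊏W = n<1+n lo , ≤-reflexive (end-V lo e)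
      where
      end-V : ∀ lo e → suc (suc lo + suc e) ≡ lo + (3 + e)
      end-V = solve-∀
    J⊆V : All (_∈ʷ V) J
    J⊆V = firstIndices-within V ≤-refl
    J<n : All (_< n) J
    J<n = All.map (λ i∈V → <-trans (proj₂ (⊏-inside V⊏W i∈V)) fits) J⊆V
    sums : DistinctSums
    sums = singletons J (unique-firstIndices V (2 + e)) J<n
    D : DoublableIn W
    D = record
      { sums = sums
      ; p = a (start V)
      ; q = a (end V)
      ; inside = All.map (⊏-inside V⊏W) J⊆V
      ; diam = diamBound-window J⊆V (<-trans (proj₂ V⊏W) fits)
      ; narrow = ⊏-narrow V⊏W fits
      }
    open Doubling (m<m+n lo (s≤s z≤n)) fits D
    length-T : length (T sums) ≡ 2 + e
    length-T = trans (length-map a J) (length-firstIndices V (2 + e))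
    regroup : ∀ e → 3 + e + 4 ≡ (2 + e) + (2 + 3)
    regroup = solve-∀

  record Split (lo x : ℕ) : Set where
    field
      Y Z : Window
      Y⊏W : Y ⊏ [ lo ,+ 3 + x ]
      Z⊏W : Z ⊏ [ lo ,+ 3 + x ]
      apart : ∀ {i j} → i ∈ʷ Y → j ∈ʷ Z → i ≢ j
      Y-balanced : Balanced x (len Y)
      Z-balanced : Balanced x (len Z)
      -- 2 (a (end Y) − a (start Y)) < a (lo + (3 + x)) − a lo
      Y-narrow : (a (end Y) +ᵣ a (end Y)) +ᵣ a lo <ᵣ (a (start Y) +ᵣ a (start Y)) +ᵣ a (lo + (3 + x))

  split-halves : ∀ lo h h′ → Balanced (h + h′) h → Balanced (h + h′) h′ → lo + (3 + (h + h′)) < n →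
                 Split lo (h + h′)
  split-halves lo h h′ h-balanced h′-balanced fits =
    Sum.[ L-first , U-first ]′
      (narrower-half (a-increasing (n<1+n lo) startL<n) (a-increasing (n<1+n _) startU<n) (a-increasing U-end fits))
    where
    L U : Window
    L = [ suc lo ,+ h ]
    U = [ suc (suc (lo + h)) ,+ h′ ]
    U-end : end U < lo + (3 + (h + h′))
    U-end = ≤-reflexive (end-U lo h h′)
      where
      end-U : ∀ lo h h′ → suc (suc (suc (lo + h)) + h′) ≡ lo + (3 + (h + h′))
      end-U = solve-∀
    startU<n : start U < n
    startU<n = ≤-<-trans (m≤m+n _ h′) (<-trans U-end fits)
    startL<n : start L < n
    startL<n = <-trans (s≤s (s≤s (m≤m+n lo h))) startU<n
    L⊏W : L ⊏ [ lo ,+ 3 + (h + h′) ]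
    L⊏W = n<1+n lo , <-trans (n<1+n _) (≤-<-trans (m≤m+n _ h′) U-end)
    U⊏W : U ⊏ [ lo ,+ 3 + (h + h′) ]
    U⊏W = s≤s (≤-trans (m≤m+n lo h) (n≤1+n _)) , U-end
    L-before-U : ∀ {i j} → i ∈ʷ L → j ∈ʷ U → i < j
    L-before-U (_ , i≤end) (start≤j , _) = ≤-trans (s≤s i≤end) start≤j
    L-first : (a (end L) +ᵣ a (end L)) +ᵣ a lo <ᵣ (a (start L) +ᵣ a (start L)) +ᵣ a (lo + (3 + (h + h′))) →
              Split lo (h + h′)
    L-first L-narrow = record
      { Y = L ; Z = U ; Y⊏W = L⊏W ; Z⊏W = U⊏W
      ; apart = λ i∈L j∈U → <⇒≢ (L-before-U i∈L j∈U)
      ; Y-balanced = h-balanced ; Z-balanced = h′-balanced ; Y-narrow = L-narrow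
      }
    U-first : (a (end U) +ᵣ a (end U)) +ᵣ a lo <ᵣ (a (start U) +ᵣ a (start U)) +ᵣ a (lo + (3 + (h + h′))) →
              Split lo (h + h′)
    U-first U-narrow = record
      { Y = U ; Z = L ; Y⊏W = U⊏W ; Z⊏W = L⊏W
      ; apart = λ i∈U j∈L → ≢-sym (<⇒≢ (L-before-U j∈L i∈U))
      ; Y-balanced = h′-balanced ; Z-balanced = h-balanced ; Y-narrow = U-narrow
      }

  split : ∀ lo x → lo + (3 + x) < n → Split lo x
  split lo x with ⌊ x /2⌋ | ⌈ x /2⌉ | ⌊/2⌋-balanced x | ⌈/2⌉-balanced x | ⌊n/2⌋+⌈n/2⌉≡n x
  ... | h | h′ | h-balanced | h′-balanced | refl = split-halves lo h h′ h-balanced h′-balanced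

  windowSums-split : ∀ {lo x} → lo + (3 + x) < n → (sp : Split lo x) → WindowSums (Split.Y sp) →
                     WindowSums [ lo ,+ 3 + x ]
  windowSums-split {lo} {x} fits sp Y-sums = record
    { sums = doubled
    ; e = e
    ; within = doubled-within
    ; size = trans (cong (2 +_) size) (size-step (s sums) e)
    ; e≤11 = e≤11
    ; few-summands = begin
        2 ^ suc (s sums)  ≤⟨ *-monoʳ-≤ 2 few-summands ⟩
        2 * len Y         ≡⟨ twice (len Y) ⟩
        len Y + len Y     ≤⟨ proj₂ Y-balanced ⟩
        suc x             ≤⟨ m≤n+m (suc x) 2 ⟩
        3 + x             ∎
    ; diam = doubled-diam
    ; many = begin
        3 + x + 4                       ≡⟨ regroup x ⟩
        x + 7                           ≤⟨ +-monoˡ-≤ 7 (proj₁ Y-balanced) ⟩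
        suc (len Y + len Y) + 7         ≡⟨ regroup′ (len Y) ⟩
        (len Y + 4) + (len Y + 4)       ≤⟨ +-mono-≤ many many ⟩
        length (T sums) + length (T sums) ≡⟨ length-doubled ⟨
        length (T doubled)              ∎
    }
    where
    open Split sp
    open WindowSums Y-sums
    open ≤-Reasoning hiding (start)
    D : DoublableIn [ lo ,+ 3 + x ]
    D = record
      { sums = sums
      ; p = a (start Y) +ᵣ a (start Y)
      ; q = a (end Y) +ᵣ a (end Y)
      ; inside = All.map (⊏-inside Y⊏W) within
      ; diam = diam
      ; narrow = Y-narrow
      }
    open Doubling (m<m+n lo (s≤s z≤n)) fits D
    size-step : ∀ s e → 2 + (s + s + e) ≡ suc s + suc s + e
    size-step = solve-∀
    twice : ∀ p → 2 * p ≡ p + p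
    twice = solve-∀
    regroup : ∀ x → 3 + x + 4 ≡ x + 7
    regroup = solve-∀
    regroup′ : ∀ p → suc (p + p) + 7 ≡ (p + 4) + (p + 4)
    regroup′ = solve-∀

  windowSums : ∀ m lo → 6 ≤ m → lo + m < n → WindowSums [ lo ,+ m ]
  windowSums = <-rec _ go
    where
    go : ∀ m → (∀ {m′} → m′ < m → ∀ lo → 6 ≤ m′ → lo + m′ < n → WindowSums [ lo ,+ m′ ]) →
         ∀ lo → 6 ≤ m → lo + m < n → WindowSums [ lo ,+ m ]
    go (suc (suc (suc x))) shorter lo (s≤s (s≤s (s≤s 3≤x))) fits with x ≤? 11
    ... | yes x≤11 = windowSums-small lo x 3≤x x≤11 fits
    ... | no x≰11 = windowSums-split fits sp (shorter Y-shorter (start Y) Y-long (<-trans (proj₂ Y⊏W) fits))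
      where
      sp : Split lo x
      sp = split lo x fits
      open Split sp
      Y-shorter : len Y < 3 + x
      Y-shorter = s≤s (≤-trans (m≤m+n (len Y) (len Y)) (≤-trans (proj₂ Y-balanced) (n≤1+n _)))
      Y-long : 6 ≤ len Y
      Y-long = balanced-≥ 6 Y-balanced (≰⇒> x≰11)

  record LogSizeSums : Set where
    field
      sums : DistinctSums
      bounded : All (_< n) (I sums)
      even : length (I sums) ≡ s sums * 2
      few-summands : 2 ^ s sums ≤ n ^ 10
      many : n ≤ length (T sums)

  logSizeSums : 24 ≤ n → LogSizeSums
  logSizeSums 24≤n = record
    { sums = doubled
    ; bounded = All.map (λ i∈W → ≤-<-trans (proj₂ i∈W) fits) doubled-within
    ; even = begin-equality
        2 + length (I sums ++ Q)          ≡⟨ cong (2 +_) (length-++ (I sums)) ⟩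
        2 + (length (I sums) + length Q)  ≡⟨ cong₂ (λ k l → 2 + (k + l)) size length-Q ⟩
        2 + ((s sums + s sums + e) + e)   ≡⟨ even-size (s sums) e ⟩
        suc (s sums + e) * 2              ≡⟨ cong (λ l → suc (s sums + l) * 2) length-Q ⟨
        suc (s sums + length Q) * 2       ∎
    ; few-summands = begin
        2 ^ suc (s sums + length Q)  ≡⟨ cong (λ l → 2 * 2 ^ (s sums + l)) length-Q ⟩
        2 * 2 ^ (s sums + e)         ≡⟨ cong (2 *_) (^-distribˡ-+-* 2 (s sums) e) ⟩
        2 * (2 ^ s sums * 2 ^ e)     ≤⟨ *-monoʳ-≤ 2 (*-mono-≤ (≤-trans few-summands len-Y≤n) (^-monoʳ-≤ 2 e≤11)) ⟩
        2 * (n * 2 ^ 11)             ≡⟨ constant n ⟩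
        4096 * n                     ≤⟨ *-monoˡ-≤ n (≤-trans (≤ᵇ⇒≤ 4096 (24 ^ 9) _) (^-monoˡ-≤ 9 24≤n)) ⟩
        n ^ 9 * n                    ≡⟨ *-comm (n ^ 9) n ⟩
        n ^ 10                       ∎
    ; many = begin
        n                                      ≡⟨ 4+x≡n ⟨
        4 + x                                  ≤⟨ +-monoʳ-≤ 4 (proj₁ Y-balanced) ⟩
        4 + suc (len Y + len Y)                ≤⟨ m≤m+n _ 3 ⟩
        4 + suc (len Y + len Y) + 3            ≡⟨ regroup (len Y) ⟩
        (len Y + 4) + (len Y + 4)              ≤⟨ +-mono-≤ many many ⟩
        length (T sums) + length (T sums)      ≡⟨ cong₂ _+_ (length-map _ (T sums)) (length-map _ (T sums)) ⟨
        length (T padded) + length (T padded)  ≡⟨ length-doubled ⟨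
        length (T doubled)                     ∎
    }
    where
    open ≤-Reasoning hiding (start)
    x : ℕ
    x = n ∸ 4
    4+x≡n : 4 + x ≡ n
    4+x≡n = m+[n∸m]≡n (≤-trans (≤ᵇ⇒≤ 4 24 _) 24≤n)
    fits : 3 + x < n
    fits = ≤-reflexive 4+x≡n
    20≤x : 20 ≤ x
    20≤x = ∸-monoˡ-≤ 4 24≤n
    open Split (split 0 x fits)
    Y-fits : end Y < n
    Y-fits = <-trans (proj₂ Y⊏W) fits
    Y-long : 6 ≤ len Y
    Y-long = balanced-≥ 6 Y-balanced (≤-trans (≤ᵇ⇒≤ 12 20 _) 20≤x)
    open WindowSums (windowSums (len Y) (start Y) Y-long Y-fits)
    len-Y≤n : len Y ≤ n
    len-Y≤n = ≤-trans (m≤n+m (len Y) (start Y)) (<⇒≤ Y-fits)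
    Q : List ℕ
    Q = firstIndices Z e
    length-Q : length Q ≡ e
    length-Q = length-firstIndices Z e
    Q⊆Z : All (_∈ʷ Z) Q
    Q⊆Z = firstIndices-within Z (≤-trans e≤11 (s≤s (balanced-≥ 10 Z-balanced 20≤x)))
    I-apart-Q : Disjoint (I sums) Q
    I-apart-Q (i∈I , i∈Q) = apart (All.lookup within i∈I) (All.lookup Q⊆Z i∈Q) refl
    padded : DistinctSums
    padded = pad sums Q (unique-firstIndices Z e) I-apart-Q
    D : DoublableIn [ 0 ,+ 3 + x ]
    D = record
      { sums = padded
      ; p = a (start Y) +ᵣ a (start Y)
      ; q = a (end Y) +ᵣ a (end Y)
      ; inside = All.++⁺ (All.map (⊏-inside Y⊏W) within) (All.map (⊏-inside Z⊏W) Q⊆Z)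
      ; diam = diamBound-shift _ diam
      ; narrow = Y-narrow
      }
    open Doubling (s≤s z≤n) fits D
    even-size : ∀ s e → 2 + ((s + s + e) + e) ≡ suc (s + e) * 2
    even-size = solve-∀
    constant : ∀ n → 2 * (n * 2 ^ 11) ≡ 4096 * n
    constant = solve-∀
    regroup : ∀ p → 4 + suc (p + p) + 3 ≡ (p + 4) + (p + 4)
    regroup = solve-∀

  restricted-sumset-of-log-size : ∀ (A : List ℝ) → (∀ {i} → i < n → a i ∈ A) → 24 ≤ n →
    ∃ λ B → Unique B × All (_∈ A) B × (2 ^ length B ≤ n ^ 20)
          × CardAtLeast R (InRestrictedSumset R (length B / 2) B) n
  restricted-sumset-of-log-size A a∈A 24≤n =
    B , unique-map-a (I-unique sums) bounded , All.map⁺ (All.map a∈A bounded) , few-elements ,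
    T sums , T-unique sums , All.map halved (T-sums sums) , many
    where
    open LogSizeSums (logSizeSums 24≤n)
    open ≤-Reasoning hiding (start)
    B : List ℝ
    B = map a (I sums)
    length-B : length B ≡ s sums * 2
    length-B = trans (length-map a (I sums)) even
    half : length B / 2 ≡ s sums
    half = trans (cong (_/ 2) length-B) (m*n/n≡m (s sums) 2)
    halved : ∀ {t} → InRestrictedSumset R (s sums) B t → InRestrictedSumset R (length B / 2) B t
    halved {t} = subst (λ k → InRestrictedSumset R k B t) (sym half)
    few-elements : 2 ^ length B ≤ n ^ 20
    few-elements = begin
      2 ^ length B       ≡⟨ cong (2 ^_) length-B ⟩
      2 ^ (s sums * 2)   ≡⟨ ^-*-assoc 2 (s sums) 2 ⟨
      (2 ^ s sums) ^ 2   ≤⟨ ^-monoˡ-≤ 2 few-summands ⟩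
      (n ^ 10) ^ 2       ≡⟨ ^-*-assoc n 10 2 ⟩
      n ^ 20             ∎

open import Data.Nat using (_≤_; _^_; _/_)

lemma7p9 : (R : RealNumbers) → ∃ λ (N : ℕ) →
    (A : List (RealNumbers.ℝ R)) → Unique A → N ≤ length A →
    ∃ λ (B : List (RealNumbers.ℝ R)) → Unique B × All (λ b → b ∈ A) B
      × (2 ^ length B ≤ length A ^ 20)
      × CardAtLeast R (InRestrictedSumset R (length B / 2) B) (length A)
lemma7p9 R = 24 , λ A A-unique 24≤|A| →
  let open Sorting.IncreasingEnumeration (Sorting.enumerate R A-unique)
  in Windows.restricted-sumset-of-log-size R (length A) a a-increasing A a-∈ 24≤|A|
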